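{- For every odd integer $n\geq 5$, $\chi_{lid}(C_5\square C_n)=4$.
   Context: $C_n$ denotes the cycle on $n$ vertices. A proper $k$-coloring of a graph $G$ is a map $f:V(G)\to\{1,\dots,k\}$ with $f(u)\neq f(v)$ for every edge $uv$. For a vertex $v$, $N[v]$ denotes its closed neighborhood, and $f(S)=\{f(x):x\in S\}$. A lid-coloring of $G$ is a proper coloring $f$ such that for every edge $uv$ with $N[u]\neq N[v]$ we have $f(N[u])\neq f(N[v])$; $\chi_{lid}(G)$ is the smallest number of colors in a lid-coloring of $G$. The Cartesian product $G\square H$ has vertex set $V(G)\times V(H)$, where $(u_1,v_1)$ and $(u_2,v_2)$ are adjacent iff either $u_1=u_2$ and $v_1v_2\in E(H)$, or $v_1=v_2$ and $u_1u_2\in E(G)$. -}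

module Defs where

open import Level using (0ℓ)
open import Data.Nat using (ℕ; zero; suc)
open import Data.Fin using (Fin; toℕ)
open import Data.Product using (Σ; _×_; _,_; ∃)
open import Data.Sum using (_⊎_)
open import Relation.Binary.PropositionalEquality using (_≡_; _≢_)
open import Relation.Nullary using (¬_)
open import Function.Bundles using (_⇔_)

record Graph : Set₁ where
  field
    V   : Set
    Adj : V → V → Set
open Graph public

-- The cycle C_n on vertices 0,…,n-1: i ~ j iff j = i+1 or i = j+1 (mod n).
-- (For n ≥ 3 this is exactly the cycle graph.)
CycAdj : (n : ℕ) → Fin n → Fin n → Set
CycAdj n i j =
  (suc (toℕ i) ≡ toℕ j) ⊎ (suc (toℕ j) ≡ toℕ i)
  ⊎ ((suc (toℕ i) ≡ n) × (toℕ j ≡ 0))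
  ⊎ ((suc (toℕ j) ≡ n) × (toℕ i ≡ 0))

Cycle : ℕ → Graph
Cycle n = record { V = Fin n ; Adj = CycAdj n }

_□_ : Graph → Graph → Graph
G □ H = record
  { V   = V G × V H
  ; Adj = λ { (u₁ , v₁) (u₂ , v₂) →
              ((u₁ ≡ u₂) × Adj H v₁ v₂) ⊎ ((v₁ ≡ v₂) × Adj G u₁ u₂) } }

InN : (G : Graph) → V G → V G → Set
InN G v x = (x ≡ v) ⊎ Adj G v x

SameN : (G : Graph) → V G → V G → Set
SameN G u v = ∀ x → InN G u x ⇔ InN G v x

ColorIn : (G : Graph) {k : ℕ} → (V G → Fin k) → V G → Fin k → Set
ColorIn G f v c = ∃ λ x → InN G v x × (f x ≡ c)

SameColors : (G : Graph) {k : ℕ} → (V G → Fin k) → V G → V G → Set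
SameColors G f u v = ∀ c → ColorIn G f u c ⇔ ColorIn G f v c

IsProper : (G : Graph) {k : ℕ} → (V G → Fin k) → Set
IsProper G f = ∀ u v → Adj G u v → f u ≢ f v

IsLid : (G : Graph) {k : ℕ} → (V G → Fin k) → Set
IsLid G f = IsProper G f ×
  (∀ u v → Adj G u v → ¬ SameN G u v → ¬ SameColors G f u v)

ChiLidIs : Graph → ℕ → Set
ChiLidIs G k =
  (Σ (V G → Fin k) λ f → IsLid G f)
  × (∀ m → Data.Nat._<_ m k → (f : V G → Fin m) → ¬ IsLid G f)

-- With at most three colours, if some N[u] of a proper colouring sees a colour other than those
-- of the two ends of an edge uv, it sees every colour. So two adjacent vertices that both see
-- all colours, or both do not, see the same colour set; in a lid-colouring "N[u] sees every
-- colour" must therefore alternate along the odd cycle C₅ × {0}, which is impossible.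
--
-- Conversely, write an odd n ≥ 5 as 5 + 4t or 7 + 4t and colour column k of C₅ □ Cₙ by the k-th
-- column of a closed walk in a small automaton of column colourings: one loop of length 5 or 7
-- followed by t loops of length 4, all through a common column A. Every lid condition concerns
-- at most four consecutive columns, so checking all walks of length three in the automaton,
-- which is done by evaluation, proves the colouring is a lid-colouring.
module Submission where

open import Defs
open import Data.Nat using (ℕ; _≤_; _%_)
open import Relation.Binary.PropositionalEquality using (_≡_)

open import Data.Bool using () renaming (_≟_ to _≟ᵇ_)
open import Data.Empty using (⊥; ⊥-elim)
open import Data.Fin using (Fin; toℕ; fromℕ<; punchOut; #_) renaming (zero to fzero; suc to fsuc)
open import Data.Fin.Properties using (punchOut-injective; toℕ<n; toℕ-fromℕ<; all?)
  renaming (_≟_ to _≟ᶠ_)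
open import Data.Fin.Subset using (Subset; ⁅_⁆; _∪_) renaming (⊥ to ∅; _∈_ to _∈ₛ_)
open import Data.Fin.Subset.Properties
  using (⊆-antisym; x∈p∪q⁻; x∈p∪q⁺; x∈⁅x⁆; x∈⁅y⁆⇒x≡y; ∉⊥)
open import Data.List using (List; []; _∷_; foldr)
open import Data.List.Membership.Propositional using (_∈_)
open import Data.List.Relation.Unary.All as All using (All)
open import Data.List.Relation.Unary.Any using (here; there)
open import Data.Nat using (zero; suc; _+_; _*_; _∸_; _<_; s≤s; z≤n) renaming (_≟_ to _≟ⁿ_)
open import Data.Nat.Properties using (≤∧≢⇒<; <⇒≢; n≤1+n; ≤-refl; ≤-trans; suc-injective)
open import Data.Product using (Σ; ∃; _×_; _,_; proj₁; proj₂)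
open import Data.Sum using (_⊎_; inj₁; inj₂)
open import Data.Vec.Properties using (≡-dec)
open import Function using (_∘_)
open import Function.Bundles using (_⇔_; mk⇔; Equivalence)
open import Relation.Binary.Definitions using (Symmetric)
open import Relation.Binary.PropositionalEquality using (_≢_; refl; sym; trans; cong; subst)
open import Relation.Nullary using (¬_; Dec; yes; no; ¬?; _×-dec_)
open import Relation.Nullary.Decidable using (from-yes)

open Equivalence using (to; from)

CycAdj-sym : ∀ {n} → Symmetric (CycAdj n)
CycAdj-sym (inj₁ e)               = inj₂ (inj₁ e)
CycAdj-sym (inj₂ (inj₁ e))        = inj₁ e
CycAdj-sym (inj₂ (inj₂ (inj₁ p))) = inj₂ (inj₂ (inj₂ p))
CycAdj-sym (inj₂ (inj₂ (inj₂ p))) = inj₂ (inj₂ (inj₁ p))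

□-sym : ∀ {G H} → Symmetric (Adj G) → Symmetric (Adj H) → Symmetric (Adj (G □ H))
□-sym G-sym H-sym (inj₁ (e , a)) = inj₁ (sym e , H-sym a)
□-sym G-sym H-sym (inj₂ (e , a)) = inj₂ (sym e , G-sym a)

next : ℕ → ℕ → ℕ
next n k with suc k ≟ⁿ n
... | yes _ = 0
... | no _  = suc k

-- prev n 0 is meaningful only for n ≥ 1.
prev : ℕ → ℕ → ℕ
prev n zero    = n ∸ 1
prev n (suc k) = k

next-last : ∀ {n k} → suc k ≡ n → next n k ≡ 0
next-last {n} {k} e with suc k ≟ⁿ n
... | yes _ = refl
... | no ne = ⊥-elim (ne e)

next-inner : ∀ {n k} → suc k ≢ n → next n k ≡ suc k
next-inner {n} {k} ne with suc k ≟ⁿ n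
... | yes e = ⊥-elim (ne e)
... | no _  = refl

next< : ∀ {n k} → k < n → next n k < n
next< {n} {k} k<n with suc k ≟ⁿ n
next< {suc n} k<n | yes _ = s≤s z≤n
...               | no ne = ≤∧≢⇒< k<n ne

prev< : ∀ {n k} → k < n → prev n k < n
prev< {suc n} {zero}  _         = ≤-refl
prev< {n}     {suc k} (s≤s k<n) = s≤s (≤-trans (n≤1+n k) k<n)

prev-next : ∀ {n k} → k < n → prev n (next n k) ≡ k
prev-next {n} {k} k<n with suc k ≟ⁿ n
... | yes e = cong (_∸ 1) (sym e)
... | no _  = refl

next-prev : ∀ {n k} → k < n → next n (prev n k) ≡ k
next-prev {suc n} {zero}  _   = next-last refl
next-prev {n}     {suc k} k<n = next-inner (<⇒≢ k<n)

CycAdj⇒next⊎prev : ∀ {n} {j j′ : Fin n} → CycAdj n j j′ →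
                   toℕ j′ ≡ next n (toℕ j) ⊎ toℕ j′ ≡ prev n (toℕ j)
CycAdj⇒next⊎prev {j′ = j′} (inj₁ e) =
  inj₁ (sym (trans (next-inner (<⇒≢ (subst (_< _) (sym e) (toℕ<n j′)))) e))
CycAdj⇒next⊎prev (inj₂ (inj₁ e)) rewrite sym e = inj₂ refl
CycAdj⇒next⊎prev (inj₂ (inj₂ (inj₁ (e , j′≡0)))) = inj₁ (trans j′≡0 (sym (next-last e)))
CycAdj⇒next⊎prev (inj₂ (inj₂ (inj₂ (e , j≡0)))) rewrite j≡0 = inj₂ (cong (_∸ 1) e)

next⇒CycAdj : ∀ {n} (j j′ : Fin n) → toℕ j′ ≡ next n (toℕ j) → CycAdj n j j′
next⇒CycAdj {n} j j′ e with suc (toℕ j) ≟ⁿ n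
... | yes last = inj₂ (inj₂ (inj₁ (last , e)))
... | no _     = inj₁ (sym e)

prev⇒CycAdj : ∀ {n} (j j′ : Fin n) → toℕ j′ ≡ prev n (toℕ j) → CycAdj n j j′
prev⇒CycAdj {suc n} fzero    j′ e = inj₂ (inj₂ (inj₂ (cong suc e , refl)))
prev⇒CycAdj         (fsuc j) j′ e = inj₂ (inj₁ (cong suc e))

CycAdj-elim : ∀ {n} (R : ℕ → ℕ → Set) → (∀ {a b} → R a b → R b a) →
              (∀ (j : Fin n) → R (toℕ j) (next n (toℕ j))) →
              ∀ {j j′ : Fin n} → CycAdj n j j′ → R (toℕ j) (toℕ j′)
CycAdj-elim {n} R R-sym forward {j} {j′} j~j′ with CycAdj⇒next⊎prev j~j′
... | inj₁ e = subst (R (toℕ j)) (sym e) (forward j)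
... | inj₂ e = R-sym (subst (R (toℕ j′)) j′→j (forward j′))
  where
  j′→j : next n (toℕ j′) ≡ toℕ j
  j′→j = trans (cong (next n) e) (next-prev (toℕ<n j))

NeighbourAt : ∀ n → Fin n → ℕ → Set
NeighbourAt n j a = Σ (Fin n) λ j′ → CycAdj n j j′ × toℕ j′ ≡ a

next-neighbour : ∀ {n} (j : Fin n) → NeighbourAt n j (next n (toℕ j))
next-neighbour j = fromℕ< k<n , next⇒CycAdj j _ (toℕ-fromℕ< k<n) , toℕ-fromℕ< k<n
  where k<n = next< (toℕ<n j)

prev-neighbour : ∀ {n} (j : Fin n) → NeighbourAt n j (prev n (toℕ j))
prev-neighbour j = fromℕ< k<n , prev⇒CycAdj j _ (toℕ-fromℕ< k<n) , toℕ-fromℕ< k<n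
  where k<n = prev< (toℕ<n j)

-- Fewer than four colours

fin≤1-unique : ∀ {m} → m ≤ 1 → (x y : Fin m) → x ≡ y
fin≤1-unique (s≤s z≤n) fzero fzero = refl

-- Punching a and then b out of Fin m leaves at most one element.
outside-pair-unique : ∀ {m} → m < 4 → {a b c d : Fin m} →
                      a ≢ b → c ≢ a → c ≢ b → d ≢ a → d ≢ b → c ≡ d
outside-pair-unique {suc zero} _ {fzero} {fzero} a≢b = ⊥-elim (a≢b refl)
outside-pair-unique {suc (suc m)} (s≤s (s≤s (s≤s m≤1))) {a} {b} {c} {d} a≢b c≢a c≢b d≢a d≢b =
  punchOut-injective a≢c a≢d (punchOut-injective b′≢c′ b′≢d′ (fin≤1-unique m≤1 _ _))
  where
  a≢c : a ≢ c
  a≢c = c≢a ∘ sym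
  a≢d : a ≢ d
  a≢d = d≢a ∘ sym
  b′≢c′ : punchOut a≢b ≢ punchOut a≢c
  b′≢c′ = c≢b ∘ sym ∘ punchOut-injective a≢b a≢c
  b′≢d′ : punchOut a≢b ≢ punchOut a≢d
  b′≢d′ = d≢b ∘ sym ∘ punchOut-injective a≢b a≢d

Alternating : Set → Set → Set
Alternating A B = ¬ (A × B) × ¬ (¬ A × ¬ B)

module _ {A B : Set} (alt : Alternating A B) where

  alternating-¬¬⇒¬ : ¬ ¬ A → ¬ B
  alternating-¬¬⇒¬ ¬¬a b = ¬¬a (λ a → proj₁ alt (a , b))

  alternating-¬⇒¬¬ : ¬ A → ¬ ¬ B
  alternating-¬⇒¬¬ ¬a ¬b = proj₂ alt (¬a , ¬b)

alternating-5-cycle : {A B C D E : Set} → Alternating A B → Alternating B C →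
                      Alternating C D → Alternating D E → Alternating E A → ⊥
alternating-5-cycle ab bc cd de ea = ¬¬a ¬a
  where
  ¬a : ¬ _
  ¬a a = ( alternating-¬¬⇒¬ ea ∘ alternating-¬⇒¬¬ de ∘ alternating-¬¬⇒¬ cd
         ∘ alternating-¬⇒¬¬ bc ∘ alternating-¬¬⇒¬ ab) (λ ¬a → ¬a a) a
  ¬¬a : ¬ ¬ _
  ¬¬a = ( alternating-¬⇒¬¬ ea ∘ alternating-¬¬⇒¬ de ∘ alternating-¬⇒¬¬ cd
        ∘ alternating-¬¬⇒¬ bc ∘ alternating-¬⇒¬¬ ab) ¬a

Full : (G : Graph) {k : ℕ} → (V G → Fin k) → V G → Set
Full G f u = ∀ c → ColorIn G f u c

module _ (G : Graph) (adj-sym : Symmetric (Adj G)) {m : ℕ} (m<4 : m < 4) (f : V G → Fin m) where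

  outsider⇒Full : ∀ {u v c} → Adj G u v → f u ≢ f v → c ≢ f u → c ≢ f v →
                     ColorIn G f u c → Full G f u
  outsider⇒Full {u} {v} u~v fu≢fv c≢fu c≢fv (x , x∈N[u] , fx≡c) d
    with d ≟ᶠ f u | d ≟ᶠ f v
  ... | yes d≡fu | _        = u , inj₁ refl , sym d≡fu
  ... | no _     | yes d≡fv = v , inj₂ u~v , sym d≡fv
  ... | no d≢fu  | no d≢fv  =
    x , x∈N[u] , trans fx≡c (outside-pair-unique m<4 fu≢fv c≢fu c≢fv d≢fu d≢fv)

  both-¬Full⇒SameColors : ∀ {u v} → Adj G u v → f u ≢ f v →
                       ¬ Full G f u → ¬ Full G f v → SameColors G f u v
  both-¬Full⇒SameColors {u} {v} u~v fu≢fv ¬full-u ¬full-v c with c ≟ᶠ f u | c ≟ᶠ f v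
  ... | yes c≡fu | _ =
    mk⇔ (λ _ → u , inj₂ (adj-sym u~v) , sym c≡fu) (λ _ → u , inj₁ refl , sym c≡fu)
  ... | no _ | yes c≡fv =
    mk⇔ (λ _ → v , inj₁ refl , sym c≡fv) (λ _ → v , inj₂ u~v , sym c≡fv)
  ... | no c≢fu | no c≢fv =
    mk⇔ (⊥-elim ∘ ¬full-u ∘ outsider⇒Full u~v fu≢fv c≢fu c≢fv)
        (⊥-elim ∘ ¬full-v ∘ outsider⇒Full (adj-sym u~v) (fu≢fv ∘ sym) c≢fv c≢fu)

  IsLid⇒Full-alternates : IsLid G f → ∀ {u v} → Adj G u v → ¬ SameN G u v →
                        Alternating (Full G f u) (Full G f v)
  IsLid⇒Full-alternates (proper , lid) u~v N[u]≢N[v] =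
      (λ (full-u , full-v) →
         lid _ _ u~v N[u]≢N[v] (λ c → mk⇔ (λ _ → full-v c) (λ _ → full-u c)))
    , (λ (¬full-u , ¬full-v) →
         lid _ _ u~v N[u]≢N[v] (both-¬Full⇒SameColors u~v (proper _ _ u~v) ¬full-u ¬full-v))

module _ (k : ℕ) where

  private
    G : Graph
    G = Cycle 5 □ Cycle (2 + k)

  -- (a , 1) lies in N[(a , 0)] but not in N[(b , 0)].
  first-column-distinguished : ∀ {a b} → a ≢ b → ¬ SameN G (a , fzero) (b , fzero)
  first-column-distinguished {a} a≢b same
    with to (same (a , fsuc fzero)) (inj₂ (inj₁ (refl , inj₁ refl)))
  ... | inj₁ ()
  ... | inj₂ (inj₁ (b≡a , _)) = a≢b (sym b≡a)
  ... | inj₂ (inj₂ (() , _))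

  no-lid-colouring-below-4 : ∀ m → m < 4 → (f : V G → Fin m) → ¬ IsLid G f
  no-lid-colouring-below-4 m m<4 f lid =
    alternating-5-cycle (alternate (inj₁ refl) (λ ()))
                        (alternate (inj₁ refl) (λ ()))
                        (alternate (inj₁ refl) (λ ()))
                        (alternate (inj₁ refl) (λ ()))
                        (alternate (inj₂ (inj₂ (inj₁ (refl , refl)))) (λ ()))
    where
    alternate : ∀ {a b} → CycAdj 5 a b → a ≢ b →
                Alternating (Full G f (a , fzero)) (Full G f (b , fzero))
    alternate a~b a≢b =
      IsLid⇒Full-alternates G (□-sym CycAdj-sym CycAdj-sym) m<4 f lid
        (inj₂ (refl , a~b)) (first-column-distinguished a≢b)

palette : ∀ {k} → List (Fin k) → Subset k
palette = foldr (λ c p → ⁅ c ⁆ ∪ p) ∅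

∈⇒∈palette : ∀ {k} {c : Fin k} {xs} → c ∈ xs → c ∈ₛ palette xs
∈⇒∈palette {c = c} (here refl) = x∈p∪q⁺ (inj₁ (x∈⁅x⁆ c))
∈⇒∈palette         (there c∈)  = x∈p∪q⁺ (inj₂ (∈⇒∈palette c∈))

∈palette⇒∈ : ∀ {k} {c : Fin k} xs → c ∈ₛ palette xs → c ∈ xs
∈palette⇒∈ []       c∈ = ⊥-elim (∉⊥ c∈)
∈palette⇒∈ (x ∷ xs) c∈ with x∈p∪q⁻ ⁅ x ⁆ (palette xs) c∈
... | inj₁ c∈⁅x⁆ = here (x∈⁅y⁆⇒x≡y x c∈⁅x⁆)
... | inj₂ c∈xs  = there (∈palette⇒∈ xs c∈xs)

sameColors⇒samePalette : ∀ {G : Graph} {k} {f : V G → Fin k} {u v xs ys} →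
  (∀ c → ColorIn G f u c ⇔ c ∈ xs) → (∀ c → ColorIn G f v c ⇔ c ∈ ys) →
  SameColors G f u v → palette xs ≡ palette ys
sameColors⇒samePalette {xs = xs} {ys} u⇔xs v⇔ys same = ⊆-antisym
  (λ c∈ → ∈⇒∈palette (to (v⇔ys _) (to (same _) (from (u⇔xs _) (∈palette⇒∈ xs c∈)))))
  (λ c∈ → ∈⇒∈palette (to (u⇔xs _) (from (same _) (from (v⇔ys _) (∈palette⇒∈ ys c∈)))))

module _ {m n k : ℕ} (F : ℕ → ℕ → Fin k) where

  private
    Grid : Graph
    Grid = Cycle m □ Cycle n

  gridColouring : V Grid → Fin k
  gridColouring (i , j) = F (toℕ i) (toℕ j)

  neighbourColours : ℕ → ℕ → List (Fin k)
  neighbourColours a b =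
    F a b ∷ F (next m a) b ∷ F (prev m a) b ∷ F a (next n b) ∷ F a (prev n b) ∷ []

  ColorIn⇔∈neighbourColours : ∀ i j c →
    ColorIn Grid gridColouring (i , j) c ⇔ c ∈ neighbourColours (toℕ i) (toℕ j)
  ColorIn⇔∈neighbourColours i j c = mk⇔ colorIn⇒ colorIn⇐
    where
    colorIn⇒ : ColorIn Grid gridColouring (i , j) c → c ∈ neighbourColours (toℕ i) (toℕ j)
    colorIn⇒ (_ , inj₁ refl , refl) = here refl
    colorIn⇒ ((_ , j′) , inj₂ (inj₁ (refl , j~j′)) , refl) with CycAdj⇒next⊎prev j~j′
    ... | inj₁ e = there (there (there (here (cong (F (toℕ i)) e))))
    ... | inj₂ e = there (there (there (there (here (cong (F (toℕ i)) e)))))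
    colorIn⇒ ((i′ , _) , inj₂ (inj₂ (refl , i~i′)) , refl) with CycAdj⇒next⊎prev i~i′
    ... | inj₁ e = there (here (cong (λ a → F a (toℕ j)) e))
    ... | inj₂ e = there (there (here (cong (λ a → F a (toℕ j)) e)))

    via-row : ∀ {a} → NeighbourAt m i a → c ≡ F a (toℕ j) → ColorIn Grid gridColouring (i , j) c
    via-row (i′ , i~i′ , refl) c≡ = (i′ , j) , inj₂ (inj₂ (refl , i~i′)) , sym c≡

    via-column : ∀ {b} → NeighbourAt n j b → c ≡ F (toℕ i) b → ColorIn Grid gridColouring (i , j) c
    via-column (j′ , j~j′ , refl) c≡ = (i , j′) , inj₂ (inj₁ (refl , j~j′)) , sym c≡

    colorIn⇐ : c ∈ neighbourColours (toℕ i) (toℕ j) → ColorIn Grid gridColouring (i , j) c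
    colorIn⇐ (here c≡)                                  = (i , j) , inj₁ refl , sym c≡
    colorIn⇐ (there (here c≡))                          = via-row (next-neighbour i) c≡
    colorIn⇐ (there (there (here c≡)))                  = via-row (prev-neighbour i) c≡
    colorIn⇐ (there (there (there (here c≡))))          = via-column (next-neighbour j) c≡
    colorIn⇐ (there (there (there (there (here c≡))))) = via-column (prev-neighbour j) c≡

-- A lid-colouring with four colours

-- Column colourings of C₅, named after the loops through A that use them:
-- A P₁ P₂ P₃ P₄, A B M₂ D and A B Q₂ Q₃ Q₄ Q₅ D.
data Column : Set where
  A B D M₂ P₁ P₂ P₃ P₄ Q₂ Q₃ Q₄ Q₅ : Column

successors : Column → List Column
successors A  = P₁ ∷ B ∷ []
successors P₁ = P₂ ∷ []
successors P₂ = P₃ ∷ []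
successors P₃ = P₄ ∷ []
successors P₄ = A ∷ []
successors B  = M₂ ∷ Q₂ ∷ []
successors M₂ = D ∷ []
successors Q₂ = Q₃ ∷ []
successors Q₃ = Q₄ ∷ []
successors Q₄ = Q₅ ∷ []
successors Q₅ = D ∷ []
successors D  = A ∷ []

-- Rows are read as naturals; rows ≥ 5 get the colour of row 4.
rows : Fin 4 → Fin 4 → Fin 4 → Fin 4 → Fin 4 → ℕ → Fin 4
rows c₀ c₁ c₂ c₃ c₄ 0 = c₀
rows c₀ c₁ c₂ c₃ c₄ 1 = c₁
rows c₀ c₁ c₂ c₃ c₄ 2 = c₂
rows c₀ c₁ c₂ c₃ c₄ 3 = c₃
rows c₀ c₁ c₂ c₃ c₄ _ = c₄

colour : Column → ℕ → Fin 4
colour A  = rows (# 0) (# 1) (# 0) (# 1) (# 2)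
colour P₁ = rows (# 2) (# 0) (# 1) (# 2) (# 1)
colour P₂ = rows (# 3) (# 2) (# 3) (# 1) (# 0)
colour P₃ = rows (# 2) (# 1) (# 2) (# 0) (# 1)
colour P₄ = rows (# 1) (# 0) (# 3) (# 2) (# 3)
colour B  = rows (# 1) (# 0) (# 1) (# 2) (# 0)
colour M₂ = rows (# 0) (# 3) (# 2) (# 3) (# 2)
colour Q₂ = rows (# 0) (# 3) (# 2) (# 3) (# 1)
colour Q₃ = rows (# 1) (# 2) (# 0) (# 1) (# 2)
colour Q₄ = rows (# 2) (# 0) (# 1) (# 0) (# 1)
colour Q₅ = rows (# 3) (# 2) (# 0) (# 3) (# 2)
colour D  = rows (# 2) (# 0) (# 3) (# 2) (# 3)

-- Colour and palette of row a of column s₁ placed between s₀ and s₂. The list is exactly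
-- neighbourColours, so that viewAt below agrees definitionally with gridColouring.
view : Column → Column → Column → ℕ → Fin 4 × Subset 4
view s₀ s₁ s₂ a = colour s₁ a , palette
  (colour s₁ a ∷ colour s₁ (next 5 a) ∷ colour s₁ (prev 5 a) ∷ colour s₂ a ∷ colour s₀ a ∷ [])

Distinguishable : Fin 4 × Subset 4 → Fin 4 × Subset 4 → Set
Distinguishable (c , P) (d , Q) = c ≢ d × P ≢ Q

Distinguishable-sym : ∀ {x y} → Distinguishable x y → Distinguishable y x
Distinguishable-sym (c≢d , P≢Q) = c≢d ∘ sym , P≢Q ∘ sym

distinguishable? : ∀ x y → Dec (Distinguishable x y)
distinguishable? (c , P) (d , Q) = ¬? (c ≟ᶠ d) ×-dec ¬? (≡-dec _≟ᵇ_ P Q)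

ValidWindow : Column → Column → Column → Column → Set
ValidWindow s₀ s₁ s₂ s₃ = ∀ (i : Fin 5) →
    Distinguishable (view s₀ s₁ s₂ (toℕ i)) (view s₀ s₁ s₂ (next 5 (toℕ i)))
  × Distinguishable (view s₀ s₁ s₂ (toℕ i)) (view s₁ s₂ s₃ (toℕ i))

WindowsFrom : Column → Set
WindowsFrom s₀ = All (λ s₁ → All (λ s₂ → All (ValidWindow s₀ s₁ s₂)
                   (successors s₂)) (successors s₁)) (successors s₀)

windowsFrom? : ∀ s₀ → Dec (WindowsFrom s₀)
windowsFrom? s₀ = All.all? (λ s₁ → All.all? (λ s₂ → All.all? (λ s₃ →
  all? (λ i → distinguishable? _ _ ×-dec distinguishable? _ _))
    (successors s₂)) (successors s₁)) (successors s₀)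

windows-valid : ∀ s₀ → WindowsFrom s₀
windows-valid A  = from-yes (windowsFrom? A)
windows-valid B  = from-yes (windowsFrom? B)
windows-valid D  = from-yes (windowsFrom? D)
windows-valid M₂ = from-yes (windowsFrom? M₂)
windows-valid P₁ = from-yes (windowsFrom? P₁)
windows-valid P₂ = from-yes (windowsFrom? P₂)
windows-valid P₃ = from-yes (windowsFrom? P₃)
windows-valid P₄ = from-yes (windowsFrom? P₄)
windows-valid Q₂ = from-yes (windowsFrom? Q₂)
windows-valid Q₃ = from-yes (windowsFrom? Q₃)
windows-valid Q₄ = from-yes (windowsFrom? Q₄)
windows-valid Q₅ = from-yes (windowsFrom? Q₅)

ClosedWalk : ℕ → (ℕ → Column) → Set
ClosedWalk n walk = ∀ k → k < n → walk (next n k) ∈ successors (walk k)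

walkColour : (ℕ → Column) → ℕ → ℕ → Fin 4
walkColour walk a k = colour (walk k) a

module _ {n : ℕ} (walk : ℕ → Column) (closed : ClosedWalk n walk) where

  viewAt : ℕ → ℕ → Fin 4 × Subset 4
  viewAt a k = view (walk (prev n k)) (walk k) (walk (next n k)) a

  window-at : ∀ {k} → k < n →
    ValidWindow (walk (prev n k)) (walk k) (walk (next n k)) (walk (next n (next n k)))
  window-at {k} k<n =
    All.lookup (All.lookup (All.lookup (windows-valid _) into-k) (closed k k<n))
               (closed (next n k) (next< k<n))
    where
    into-k : walk k ∈ successors (walk (prev n k))
    into-k = subst (λ k′ → walk k′ ∈ successors (walk (prev n k)))
                   (next-prev k<n) (closed (prev n k) (prev< k<n))

  forward-distinguishable : ∀ (i : Fin 5) {k} → k < n →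
      Distinguishable (viewAt (toℕ i) k) (viewAt (next 5 (toℕ i)) k)
    × Distinguishable (viewAt (toℕ i) k) (viewAt (toℕ i) (next n k))
  forward-distinguishable i {k} k<n with window-at k<n i
  ... | down , right = down , subst right-of (sym (prev-next k<n)) right
    where
    right-of : ℕ → Set
    right-of k′ = Distinguishable (viewAt (toℕ i) k)
                    (view (walk k′) (walk (next n k)) (walk (next n (next n k))) (toℕ i))

  adjacent-distinguishable : ∀ {i j i′ j′} → Adj (Cycle 5 □ Cycle n) (i , j) (i′ , j′) →
                             Distinguishable (viewAt (toℕ i) (toℕ j)) (viewAt (toℕ i′) (toℕ j′))
  adjacent-distinguishable {i} (inj₁ (refl , j~j′)) =
    CycAdj-elim (λ k k′ → Distinguishable (viewAt (toℕ i) k) (viewAt (toℕ i) k′))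
                Distinguishable-sym (λ j → proj₂ (forward-distinguishable i (toℕ<n j))) j~j′
  adjacent-distinguishable {j = j} (inj₂ (refl , i~i′)) =
    CycAdj-elim (λ a a′ → Distinguishable (viewAt a (toℕ j)) (viewAt a′ (toℕ j)))
                Distinguishable-sym (λ i → proj₁ (forward-distinguishable i (toℕ<n j))) i~i′

  walk-lid-colouring : IsLid (Cycle 5 □ Cycle n) (gridColouring (walkColour walk))
  walk-lid-colouring =
      (λ _ _ u~v → proj₁ (adjacent-distinguishable u~v))
    , (λ { (i , j) (i′ , j′) u~v _ same →
           proj₂ (adjacent-distinguishable u~v)
             (sameColors⇒samePalette (ColorIn⇔∈neighbourColours (walkColour walk) i j)
                                     (ColorIn⇔∈neighbourColours (walkColour walk) i′ j′) same) })

returning-walk-closed : (walk : ℕ → Column) → (∀ k → walk (suc k) ∈ successors (walk k)) →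
                        ∀ {n} → walk 0 ∈ successors (walk n) → ClosedWalk (suc n) walk
returning-walk-closed walk step {n} back k _ with suc k ≟ⁿ suc n
... | yes e rewrite suc-injective e = back
... | no _  = step k

hubLoop : ℕ → Column
hubLoop 0 = A
hubLoop 1 = B
hubLoop 2 = M₂
hubLoop 3 = D
hubLoop (suc (suc (suc (suc r)))) = hubLoop r

hubLoop-step : ∀ r → hubLoop (suc r) ∈ successors (hubLoop r)
hubLoop-step 0 = there (here refl)
hubLoop-step 1 = here refl
hubLoop-step 2 = here refl
hubLoop-step 3 = here refl
hubLoop-step (suc (suc (suc (suc r)))) = hubLoop-step r

hubLoop-last : ∀ t → hubLoop (3 + t * 4) ≡ D
hubLoop-last zero    = refl
hubLoop-last (suc t) = hubLoop-last t

walk₅ : ℕ → Column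
walk₅ 0 = A
walk₅ 1 = P₁
walk₅ 2 = P₂
walk₅ 3 = P₃
walk₅ 4 = P₄
walk₅ (suc (suc (suc (suc (suc r))))) = hubLoop r

walk₅-step : ∀ k → walk₅ (suc k) ∈ successors (walk₅ k)
walk₅-step 0 = here refl
walk₅-step 1 = here refl
walk₅-step 2 = here refl
walk₅-step 3 = here refl
walk₅-step 4 = here refl
walk₅-step (suc (suc (suc (suc (suc r))))) = hubLoop-step r

walk₅-closed : ∀ t → ClosedWalk (5 + t * 4) walk₅
walk₅-closed t = returning-walk-closed walk₅ walk₅-step (back t)
  where
  back : ∀ t → A ∈ successors (walk₅ (4 + t * 4))
  back zero = here refl
  back (suc t) rewrite hubLoop-last t = here refl

walk₇ : ℕ → Column
walk₇ 0 = A
walk₇ 1 = B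
walk₇ 2 = Q₂
walk₇ 3 = Q₃
walk₇ 4 = Q₄
walk₇ 5 = Q₅
walk₇ 6 = D
walk₇ (suc (suc (suc (suc (suc (suc (suc r))))))) = hubLoop r

walk₇-step : ∀ k → walk₇ (suc k) ∈ successors (walk₇ k)
walk₇-step 0 = there (here refl)
walk₇-step 1 = there (here refl)
walk₇-step 2 = here refl
walk₇-step 3 = here refl
walk₇-step 4 = here refl
walk₇-step 5 = here refl
walk₇-step 6 = here refl
walk₇-step (suc (suc (suc (suc (suc (suc (suc r))))))) = hubLoop-step r

walk₇-closed : ∀ t → ClosedWalk (7 + t * 4) walk₇
walk₇-closed t = returning-walk-closed walk₇ walk₇-step (back t)
  where
  back : ∀ t → A ∈ successors (walk₇ (6 + t * 4))
  back zero = here refl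
  back (suc t) rewrite hubLoop-last t = here refl

odd≥5-cases : ∀ n → 5 ≤ n → n % 2 ≡ 1 → (∃ λ t → n ≡ 5 + t * 4) ⊎ (∃ λ t → n ≡ 7 + t * 4)
odd≥5-cases 1 (s≤s ()) _
odd≥5-cases 3 (s≤s (s≤s (s≤s ()))) _
odd≥5-cases 5 _ _ = inj₁ (0 , refl)
odd≥5-cases 6 _ ()
odd≥5-cases 7 _ _ = inj₂ (0 , refl)
odd≥5-cases 8 _ ()
odd≥5-cases (suc (suc (suc (suc n@(suc (suc (suc (suc (suc _))))))))) _ odd
  with odd≥5-cases n (s≤s (s≤s (s≤s (s≤s (s≤s z≤n))))) odd
... | inj₁ (t , refl) = inj₁ (suc t , refl)
... | inj₂ (t , refl) = inj₂ (suc t , refl)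

lemma12 : (n : ℕ) → 5 ≤ n → n % 2 ≡ 1 → ChiLidIs (Cycle 5 □ Cycle n) 4
lemma12 n 5≤n odd with odd≥5-cases n 5≤n odd
... | inj₁ (t , refl) =
  (gridColouring (walkColour walk₅) , walk-lid-colouring walk₅ (walk₅-closed t))
  , no-lid-colouring-below-4 (3 + t * 4)
... | inj₂ (t , refl) =
  (gridColouring (walkColour walk₇) , walk-lid-colouring walk₇ (walk₇-closed t))
  , no-lid-colouring-below-4 (5 + t * 4)
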